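{- Let $c$ be a Coxeter element of $A_n$. No position recorded by the projection $\Pi_c$ belongs to the set $Z=\{(i,u): u \text{ upper-barred},\ 1\le i\le\min(u-1,n+1-u)\}\cup\{(i,d): d\text{ lower-barred},\ \max(d+1,n+3-d)\le i\le n+1\}$.
   Context: $A_n$ is the symmetric group on $[n+1]$. A Coxeter element is $c=s_{a_1}\cdots s_{a_n}$ with $(a_1,\dots,a_n)$ a permutation of $[n]$, where $s_i$ exchanges $i,i+1$. For $i\in\{2,\dots,n\}$, $i$ is lower-barred if $i-1$ precedes $i$ in $(a_1,\dots,a_n)$, upper-barred otherwise; $d_1<\dots<d_r$ are the lower-barred and $u_1<\dots<u_s$ the upper-barred numbers. As a permutation, $c$ is the cycle $1\mapsto d_1\mapsto\cdots\mapsto d_r\mapsto n+1\mapsto u_s\mapsto\cdots\mapsto u_1\mapsto1$. The positions (of an $(n+1)\times(n+1)$ matrix) recorded by $\Pi_c$ are: for each $k=1,\dots,r$, $(d_k-1,d_k),(d_k-2,d_k),\dots,(1,d_k)$; the positions $(n,n+1),(n-1,n+1),\dots,(1,n+1)$; and for each upper-barred $u$, with $m=\min(u-1,n+1-u)$, the positions $(n+1,c(u)),(n,c^2(u)),\dots,(n+2-m,c^m(u))$, together with, if $u>\frac{n+2}{2}$, the positions $(u-1,u),(u-2,u),\dots,(m+1,u)$. -}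

module Defs where

open import Data.Nat using (ℕ; zero; suc; _+_; _*_; _∸_; _≤_; _<_; _<ᵇ_; _≡ᵇ_; _<?_; z≤n; s≤s; _⊔_; _⊓_)
open import Data.Bool using (Bool; true; false; not; if_then_else_)
open import Data.Fin using (Fin; toℕ; fromℕ<)
open import Data.Fin.Permutation using (Permutation′; _⟨$⟩ˡ_)
open import Data.List using (List; []; _∷_; _++_; map; upTo; filterᵇ; reverse)
open import Data.Product using (_×_; Σ; ∃; _,_)
open import Data.Sum using (_⊎_)
open import Relation.Nullary using (yes; no)
open import Relation.Binary.PropositionalEquality using (_≡_)

-- A Coxeter element c = s_{a_1} ⋯ s_{a_n} of A_n is given by the word
-- (a_1,…,a_n), a permutation of [n].  We encode it by π : Permutation′ n,
-- with a_k = 1 + toℕ (π ⟨$⟩ʳ (k-1)).  Hence the (0-based) position of the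
-- value v ∈ [n] in the word is toℕ (π ⟨$⟩ˡ (v-1)).
pos : {n : ℕ} → Permutation′ n → ℕ → ℕ
pos {n} π v with (v ∸ 1) <? n
... | yes p = toℕ (π ⟨$⟩ˡ fromℕ< p)
... | no _  = 0

-- Boolean test "v-1 precedes v in the word" (meaningful for 2 ≤ v ≤ n).
precedesPrev : {n : ℕ} → Permutation′ n → ℕ → Bool
precedesPrev π v = pos π (v ∸ 1) <ᵇ pos π v

LowerBarred : (n : ℕ) → Permutation′ n → ℕ → Set
LowerBarred n π i = 2 ≤ i × i ≤ n × precedesPrev π i ≡ true

UpperBarred : (n : ℕ) → Permutation′ n → ℕ → Set
UpperBarred n π i = 2 ≤ i × i ≤ n × precedesPrev π i ≡ false

range2n : ℕ → List ℕ
range2n n = map (2 +_) (upTo (n ∸ 1))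

lowerList : (n : ℕ) → Permutation′ n → List ℕ
lowerList n π = filterᵇ (precedesPrev π) (range2n n)

upperList : (n : ℕ) → Permutation′ n → List ℕ
upperList n π = filterᵇ (λ v → not (precedesPrev π v)) (range2n n)

cycleList : (n : ℕ) → Permutation′ n → List ℕ
cycleList n π = 1 ∷ lowerList n π ++ (suc n ∷ reverse (upperList n π))

cycSucc : List ℕ → ℕ → ℕ
cycSucc [] x = x
cycSucc (h ∷ t) x = go (h ∷ t) x
  where
  go : List ℕ → ℕ → ℕ
  go [] x = x
  go (y ∷ []) x = if y ≡ᵇ x then h else x
  go (y ∷ z ∷ rest) x = if y ≡ᵇ x then z else go (z ∷ rest) x

-- The Coxeter element c as a permutation of [n+1] (on ℕ, identity outside).
cox : (n : ℕ) → Permutation′ n → ℕ → ℕ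
cox n π = cycSucc (cycleList n π)

coxPow : (n : ℕ) → Permutation′ n → ℕ → ℕ → ℕ
coxPow n π zero x = x
coxPow n π (suc k) x = cox n π (coxPow n π k x)

-- Positions (i , j) (row i, column j, 1-based) recorded by Π_c.
data Recorded (n : ℕ) (π : Permutation′ n) : ℕ → ℕ → Set where
  lowerCol : ∀ {d i} → LowerBarred n π d → 1 ≤ i → i ≤ d ∸ 1 → Recorded n π i d
  lastCol  : ∀ {i} → 1 ≤ i → i ≤ n → Recorded n π i (suc n)
  upperDiag : ∀ {u k} → UpperBarred n π u → 1 ≤ k → k ≤ (u ∸ 1) ⊓ (suc n ∸ u) →
              Recorded n π (n + 2 ∸ k) (coxPow n π k u)
  upperCol : ∀ {u i} → UpperBarred n π u → n + 2 < 2 * u →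
             suc ((u ∸ 1) ⊓ (suc n ∸ u)) ≤ i → i ≤ u ∸ 1 → Recorded n π i u

InZ : (n : ℕ) → Permutation′ n → ℕ → ℕ → Set
InZ n π i j =
  (UpperBarred n π j × 1 ≤ i × i ≤ (j ∸ 1) ⊓ (suc n ∸ j))
  ⊎ (LowerBarred n π j × (suc j ⊔ (n + 3 ∸ j)) ≤ i × i ≤ suc n)

{-# OPTIONS --safe #-}
-- Apart from the positions (n+2-k, c^k(u)), every recorded position lies in a
-- column or a range of rows that Z excludes outright.  To handle these, let
-- U x and L x count the upper- and lower-barred numbers in [2, x].  The
-- cycle c sends an upper-barred number to the next smaller upper-barred
-- number (or to 1), and 1 or a lower-barred number to the next larger
-- lower-barred number (or to n+1).  So the orbit of an upper-barred u first
-- descends through upper-barred x ≤ u with U x + k = U u after k steps,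
-- reaches 1 after U u steps, and then ascends through lower-barred x with
-- k = L x + U u.  As long as k < u this forces x < u while ascending (in
-- particular n+1 is not reached), hence x ≤ k, since U x < U u and
-- L x + U x = x - 1.  For k ≤ min(u-1, n+1-u) the row n+2-k therefore exceeds
-- x - 1 while descending (x ≤ u) and is below n+3-x while ascending.
module Submission where

open import Defs
open import Data.Bool using (Bool; true; false; not; if_then_else_; T)
open import Data.Bool.Properties using (T-≡; T-not-≡; ¬-not)
open import Data.Fin.Permutation using (Permutation′)
open import Data.List using (List; []; _∷_; _++_; [_]; reverse; head)
open import Data.List.Properties using (unfold-reverse; ++-assoc; ++-identityʳ)
open import Data.List.Membership.Propositional using (_∈_; _∉_)
open import Data.List.Membership.Propositional.Properties using (∈-map⁺; ∈-map⁻; ∈-upTo⁺; ∈-upTo⁻; ∈-filter⁺; ∈-filter⁻; ∈-++⁻)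
open import Data.List.Relation.Unary.All as All using (All; []; _∷_)
open import Data.List.Relation.Unary.AllPairs using (AllPairs; []; _∷_)
open import Data.List.Relation.Unary.AllPairs.Properties as AllPairs using ()
open import Data.List.Relation.Unary.Any using (here; there)
open import Data.List.Relation.Unary.Any.Properties as Any using ()
open import Data.Maybe using (fromMaybe)
open import Data.Nat
open import Data.Nat.Properties
open import Data.Product using (_×_; _,_; proj₁; proj₂)
open import Data.Sum using (_⊎_; inj₁; inj₂)
open import Function using (_∘_; flip)
open import Function.Bundles using (Equivalence)
open import Level using (0ℓ)
open import Relation.Binary using (Rel; Asymmetric; tri<; tri≈; tri>)
open import Relation.Binary.PropositionalEquality hiding ([_])
open import Relation.Nullary using (¬_; contradiction)
open import Relation.Nullary.Decidable using (T?)

succIn : ℕ → List ℕ → ℕ → ℕ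
succIn h []      x = x
succIn h (y ∷ l) x = if y ≡ᵇ x then fromMaybe h (head l) else succIn h l x

-- The local function of cycSucc cannot be named, so it is pinned down by its
-- defining equations.
succIn-unique : ∀ h x (f : List ℕ → ℕ) → f [] ≡ x →
                (∀ a → f (a ∷ []) ≡ (if a ≡ᵇ x then h else x)) →
                (∀ a b l → f (a ∷ b ∷ l) ≡ (if a ≡ᵇ x then b else f (b ∷ l))) →
                ∀ l → f l ≡ succIn h l x
succIn-unique h x f f[] _    _   []          = f[]
succIn-unique h x f _   f[a] _   (a ∷ [])    = f[a] a
succIn-unique h x f f[] f[a] fab (a ∷ b ∷ l) =
  trans (fab a b l) (cong (if a ≡ᵇ x then b else_) (succIn-unique h x f f[] f[a] fab (b ∷ l)))

-- Abstracting h ∷ t leaves the local function applied to a fresh variable l,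
-- which is what lets the `_` be solved by it.
cycSucc-∷ : ∀ h t x → cycSucc (h ∷ t) x ≡ succIn h (h ∷ t) x
cycSucc-∷ h t x with h ∷ t in h∷t≡l | succIn-unique h x _
... | l | unique =
  trans (unique refl (λ _ → refl) (λ _ _ _ → refl) l) (cong (λ l → succIn h l x) (sym h∷t≡l))

succIn-here : ∀ h x l → succIn h (x ∷ l) x ≡ fromMaybe h (head l)
succIn-here h x l with x ≡ᵇ x in x≡ᵇx
... | true  = refl
... | false = contradiction (subst T x≡ᵇx (≡⇒≡ᵇ x x refl)) λ ()

succIn-there : ∀ h {a x} l → a ≢ x → succIn h (a ∷ l) x ≡ succIn h l x
succIn-there h {a} {x} l a≢x with a ≡ᵇ x in a≡ᵇx
... | true  = contradiction (≡ᵇ⇒≡ a x (subst T (sym a≡ᵇx) _)) a≢x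
... | false = refl

succIn-++-∉ : ∀ h {x} P l → x ∉ P → succIn h (P ++ l) x ≡ succIn h l x
succIn-++-∉ h []      l x∉P = refl
succIn-++-∉ h (a ∷ P) l x∉P =
  trans (succIn-there h (P ++ l) (λ a≡x → x∉P (here (sym a≡x))))
        (succIn-++-∉ h P l (x∉P ∘ there))

data Next (R : Rel ℕ 0ℓ) (xs : List ℕ) (x end : ℕ) : ℕ → Set where
  within : ∀ {y} → y ∈ xs → R x y → (∀ {z} → z ∈ xs → R x z → ¬ R z y) →
           Next R xs x end y
  beyond : (∀ {z} → z ∈ xs → ¬ R x z) → Next R xs x end end

module _ {R : Rel ℕ 0ℓ} (asym : Asymmetric R) where

  Next-∷ : ∀ {a xs x end y} → R a x → Next R xs x end y → Next R (a ∷ xs) x end y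
  Next-∷ Rax (within y∈ Rxy between) = within (there y∈) Rxy λ
    { (here refl) Rxa _ → asym Rax Rxa
    ; (there z∈)  Rxz   → between z∈ Rxz }
  Next-∷ Rax (beyond maximal) = beyond λ
    { (here refl) Rxa → asym Rax Rxa
    ; (there z∈)      → maximal z∈ }

  succIn-sorted : ∀ h E {xs x} → AllPairs R xs → x ∈ xs →
                  Next R xs x (fromMaybe h (head E)) (succIn h (xs ++ E) x)
  succIn-sorted h E {a ∷ as} (a<as ∷ sorted) (here refl)
    rewrite succIn-here h a (as ++ E) = successor as a<as sorted
    where
    irrefl : ∀ {v} → ¬ R v v
    irrefl Rvv = asym Rvv Rvv
    successor : ∀ as → All (R a) as → AllPairs R as →
                Next R (a ∷ as) a (fromMaybe h (head E)) (fromMaybe h (head (as ++ E)))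
    successor []       _         _          = beyond λ { (here refl) → irrefl }
    successor (b ∷ bs) (Rab ∷ _) (b<bs ∷ _) = within (there (here refl)) Rab λ
      { (here refl)         Raa _   → irrefl Raa
      ; (there (here refl)) _   Rbb → irrefl Rbb
      ; (there (there z∈))  _   Rzb → asym (All.lookup b<bs z∈) Rzb }
  succIn-sorted h E {a ∷ as} {x} (a<as ∷ sorted) (there x∈) =
    subst (Next R (a ∷ as) x _) (sym (succIn-there h (as ++ E) a≢x))
      (Next-∷ Rax (succIn-sorted h E sorted x∈))
    where
    Rax : R a x
    Rax = All.lookup a<as x∈
    a≢x : a ≢ x
    a≢x refl = asym Rax Rax

AllPairs-reverse : ∀ {a ℓ} {A : Set a} {R : Rel A ℓ} {xs} →
                   AllPairs R xs → AllPairs (flip R) (reverse xs)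
AllPairs-reverse {xs = []}     []              = []
AllPairs-reverse {xs = x ∷ xs} (x<xs ∷ sorted) rewrite unfold-reverse x xs =
  AllPairs.++⁺ (AllPairs-reverse sorted) ([] ∷ [])
    (All.tabulate λ y∈ → All.lookup x<xs (Any.reverse⁻ y∈) ∷ [])

-- #{ v | 2 ≤ v ≤ x, p v }; 1 is neither upper- nor lower-barred.
count≤ : (ℕ → Bool) → ℕ → ℕ
count≤ p zero          = 0
count≤ p (suc zero)    = 0
count≤ p (suc (suc x)) = if p (suc (suc x)) then suc (count≤ p (suc x)) else count≤ p (suc x)

module _ (p : ℕ → Bool) where

  count≤-suc-true : ∀ {x} → 1 ≤ x → p (suc x) ≡ true → count≤ p (suc x) ≡ suc (count≤ p x)
  count≤-suc-true {suc x} _ px≡true rewrite px≡true = refl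

  count≤-suc-false : ∀ {x} → p (suc x) ≡ false → count≤ p (suc x) ≡ count≤ p x
  count≤-suc-false {zero}  _          = refl
  count≤-suc-false {suc x} px≡false rewrite px≡false = refl

  count≤-≤-suc : ∀ x → count≤ p x ≤ count≤ p (suc x)
  count≤-≤-suc zero    = z≤n
  count≤-≤-suc (suc x) with p (suc (suc x))
  ... | true  = n≤1+n _
  ... | false = ≤-refl

  count≤-mono : ∀ {y x} → y ≤ x → count≤ p y ≤ count≤ p x
  count≤-mono {y} {x} y≤x with m≤n⇒m<n∨m≡n y≤x
  ... | inj₂ refl = ≤-refl
  count≤-mono {y} {suc x} _ | inj₁ (s≤s y≤x) = ≤-trans (count≤-mono y≤x) (count≤-≤-suc x)

  count≤-gap : ∀ {y x} → y ≤ x → (∀ {z} → y < z → z ≤ x → p z ≡ false) →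
               count≤ p x ≡ count≤ p y
  count≤-gap y≤x skips with m≤n⇒m<n∨m≡n y≤x
  ... | inj₂ refl = refl
  count≤-gap {y} {suc x} _ skips | inj₁ (s≤s y≤x) =
    trans (count≤-suc-false (skips (s≤s y≤x) ≤-refl))
          (count≤-gap y≤x λ y<z z≤x → skips y<z (m≤n⇒m≤1+n z≤x))

  count≤-strict : ∀ {y x} → 2 ≤ x → y < x → p x ≡ true → count≤ p y < count≤ p x
  count≤-strict {y} {suc x} (s≤s 1≤x) (s≤s y≤x) px≡true
    rewrite count≤-suc-true 1≤x px≡true = s≤s (count≤-mono y≤x)

  count≤-next : ∀ {y x} → 2 ≤ x → y < x → p x ≡ true →
                (∀ {z} → y < z → z < x → p z ≡ false) → count≤ p x ≡ suc (count≤ p y)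
  count≤-next {y} {suc x} (s≤s 1≤x) (s≤s y≤x) px≡true skips =
    trans (count≤-suc-true 1≤x px≡true)
          (cong suc (count≤-gap y≤x λ y<z z≤x → skips y<z (s≤s z≤x)))

count≤-partition : ∀ p {x} → 1 ≤ x → x ≡ suc (count≤ p x + count≤ (not ∘ p) x)
count≤-partition p {suc zero}    _ = refl
count≤-partition p {suc (suc x)} _ with p (suc (suc x)) | count≤-partition p {suc x} (s≤s z≤n)
... | true  | ih = cong suc ih
... | false | ih = cong suc (trans ih (sym (+-suc (count≤ p (suc x)) _)))

k≤1+n∸u⇒u<n+2∸k : ∀ {n u k} → u ≤ suc n → k ≤ suc n ∸ u → u < n + 2 ∸ k
k≤1+n∸u⇒u<n+2∸k {n} {u} {k} u≤1+n k≤1+n-u =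
  m+n≤o⇒m≤o∸n (suc u) (subst (suc u + k ≤_) (+-comm 2 n) (s≤s u+k≤1+n))
  where
  u+k≤1+n : u + k ≤ suc n
  u+k≤1+n = subst (u + k ≤_) (m+[n∸m]≡n u≤1+n) (+-monoʳ-≤ u k≤1+n-u)

x≤k⇒n+2∸k<n+3∸x : ∀ {n x k} → x ≤ k → k ≤ suc n → n + 2 ∸ k < n + 3 ∸ x
x≤k⇒n+2∸k<n+3∸x {n} {x} {k} x≤k k≤1+n =
  subst (_< n + 3 ∸ x) (cong (_∸ suc k) (+-suc n 2))
    (∸-monoʳ-< (s≤s x≤k) (subst (suc k ≤_) (+-comm 3 n) (s≤s (m≤n⇒m≤1+n k≤1+n))))

∈-range2n⁺ : ∀ {n v} → 2 ≤ v → v ≤ n → v ∈ range2n n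
∈-range2n⁺ {suc n} {suc (suc w)} (s≤s (s≤s z≤n)) (s≤s w<n) = ∈-map⁺ (2 +_) (∈-upTo⁺ w<n)

∈-range2n⁻ : ∀ {n v} → v ∈ range2n n → 2 ≤ v × v ≤ n
∈-range2n⁻ {suc n} v∈ with ∈-map⁻ (2 +_) v∈
... | i , i∈ , refl = s≤s (s≤s z≤n) , s≤s (∈-upTo⁻ i∈)

range2n-sorted : ∀ n → AllPairs _<_ (range2n n)
range2n-sorted n = AllPairs.map⁺ (AllPairs.applyUpTo⁺₁ _ (n ∸ 1) λ i<j _ → s<s (s<s i<j))

module Barred (n : ℕ) (π : Permutation′ n) where

  pp : ℕ → Bool
  pp = precedesPrev π

  lower⇒¬upper : ∀ {v} → LowerBarred n π v → ¬ UpperBarred n π v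
  lower⇒¬upper (_ , _ , pp≡true) (_ , _ , pp≡false) with () ← trans (sym pp≡true) pp≡false

  ∈-lowerList⁺ : ∀ {v} → LowerBarred n π v → v ∈ lowerList n π
  ∈-lowerList⁺ (2≤v , v≤n , pp≡true) =
    ∈-filter⁺ (T? ∘ pp) (∈-range2n⁺ 2≤v v≤n) (Equivalence.from T-≡ pp≡true)

  ∈-lowerList⁻ : ∀ {v} → v ∈ lowerList n π → LowerBarred n π v
  ∈-lowerList⁻ v∈ =
    let v∈range , Tpp = ∈-filter⁻ (T? ∘ pp) v∈
        2≤v , v≤n     = ∈-range2n⁻ {n} v∈range
    in  2≤v , v≤n , Equivalence.to T-≡ Tpp

  ∈-upperList⁺ : ∀ {v} → UpperBarred n π v → v ∈ upperList n π
  ∈-upperList⁺ (2≤v , v≤n , pp≡false) =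
    ∈-filter⁺ (T? ∘ not ∘ pp) (∈-range2n⁺ 2≤v v≤n) (Equivalence.from T-not-≡ pp≡false)

  ∈-upperList⁻ : ∀ {v} → v ∈ upperList n π → UpperBarred n π v
  ∈-upperList⁻ v∈ =
    let v∈range , Tnpp = ∈-filter⁻ (T? ∘ not ∘ pp) v∈
        2≤v , v≤n      = ∈-range2n⁻ {n} v∈range
    in  2≤v , v≤n , Equivalence.to T-not-≡ Tnpp

  cox≡succIn : ∀ x → cox n π x ≡ succIn 1 (cycleList n π) x
  cox≡succIn = cycSucc-∷ 1 (lowerList n π ++ suc n ∷ reverse (upperList n π))

  ascending-sorted : AllPairs _<_ (1 ∷ lowerList n π)
  ascending-sorted =
    All.tabulate (proj₁ ∘ ∈-lowerList⁻) ∷ AllPairs.filter⁺ (T? ∘ pp) (range2n-sorted n)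

  descending-sorted : AllPairs _>_ (reverse (upperList n π))
  descending-sorted = AllPairs-reverse (AllPairs.filter⁺ (T? ∘ not ∘ pp) (range2n-sorted n))

  cox-next-lower : ∀ {x} → x ≡ 1 ⊎ LowerBarred n π x →
                  Next _<_ (1 ∷ lowerList n π) x (suc n) (cox n π x)
  cox-next-lower {x} x-asc =
    subst (Next _<_ (1 ∷ lowerList n π) x (suc n)) (sym (cox≡succIn x))
      (succIn-sorted <-asym 1 (suc n ∷ reverse (upperList n π)) ascending-sorted (x∈ x-asc))
    where
    x∈ : x ≡ 1 ⊎ LowerBarred n π x → x ∈ 1 ∷ lowerList n π
    x∈ (inj₁ refl) = here refl
    x∈ (inj₂ lx)   = there (∈-lowerList⁺ lx)

  cox-next-upper : ∀ {x} → UpperBarred n π x →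
                   Next _>_ (reverse (upperList n π)) x 1 (cox n π x)
  cox-next-upper {x} ux@(2≤x , x≤n , _) =
    subst (Next _>_ RU x 1) (sym cox≡) (succIn-sorted <-asym 1 [] descending-sorted x∈)
    where
    Lo RU P : List ℕ
    Lo = lowerList n π
    RU = reverse (upperList n π)
    P  = 1 ∷ Lo ++ [ suc n ]
    x∈ : x ∈ RU
    x∈ = Any.reverse⁺ (∈-upperList⁺ ux)
    x∉ : x ∉ P
    x∉ (here refl) = <-irrefl refl 2≤x
    x∉ (there x∈) with ∈-++⁻ Lo x∈
    ... | inj₁ x∈Lo        = lower⇒¬upper (∈-lowerList⁻ x∈Lo) ux
    ... | inj₂ (here refl) = <-irrefl refl x≤n
    cox≡ : cox n π x ≡ succIn 1 (RU ++ []) x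
    cox≡ = begin
      cox n π x                          ≡⟨ cox≡succIn x ⟩
      succIn 1 (1 ∷ Lo ++ suc n ∷ RU) x  ≡⟨ cong (λ l → succIn 1 (1 ∷ l) x) (++-assoc Lo _ RU) ⟨
      succIn 1 (P ++ RU) x               ≡⟨ succIn-++-∉ 1 P RU x∉ ⟩
      succIn 1 RU x                      ≡⟨ cong (λ l → succIn 1 l x) (++-identityʳ RU) ⟨
      succIn 1 (RU ++ []) x              ∎
      where open ≡-Reasoning

  ∉upper⇒pp≡true : ∀ {z} → 2 ≤ z → z ≤ n → z ∉ reverse (upperList n π) → pp z ≡ true
  ∉upper⇒pp≡true 2≤z z≤n′ z∉ = ¬-not λ pp≡false →
    z∉ (Any.reverse⁺ (∈-upperList⁺ (2≤z , z≤n′ , pp≡false)))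

  ∉lower⇒pp≡false : ∀ {z} → 2 ≤ z → z ≤ n → z ∉ lowerList n π → pp z ≡ false
  ∉lower⇒pp≡false 2≤z z≤n′ z∉ = ¬-not λ pp≡true →
    z∉ (∈-lowerList⁺ (2≤z , z≤n′ , pp≡true))

  DescentStep AscentStep : ℕ → ℕ → Set
  DescentStep x y =
    y < x × (y ≡ 1 ⊎ UpperBarred n π y) × (∀ {z} → y < z → z < x → pp z ≡ true)
  AscentStep x y =
    x < y × (y ≡ suc n ⊎ LowerBarred n π y) × (∀ {z} → x < z → z < y → pp z ≡ false)

  cox-descent : ∀ {x} → UpperBarred n π x → DescentStep x (cox n π x)
  cox-descent {x} ux@(2≤x , x≤n , _) with cox n π x | cox-next-upper ux
  ... | y | within y∈ y<x between =
    let uy@(2≤y , _) = ∈-upperList⁻ (Any.reverse⁻ y∈) in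
    y<x , inj₂ uy , λ y<z z<x →
      ∉upper⇒pp≡true (<-trans 2≤y y<z) (<⇒≤ (<-≤-trans z<x x≤n)) λ z∈ → between z∈ z<x y<z
  ... | _ | beyond maximal =
    2≤x , inj₁ refl , λ 1<z z<x →
      ∉upper⇒pp≡true 1<z (<⇒≤ (<-≤-trans z<x x≤n)) λ z∈ → maximal z∈ z<x

  ascending-bounds : 1 ≤ n → ∀ {x} → x ≡ 1 ⊎ LowerBarred n π x → 1 ≤ x × x ≤ n
  ascending-bounds 1≤n (inj₁ refl)            = ≤-refl , 1≤n
  ascending-bounds _   (inj₂ (2≤x , x≤n , _)) = <⇒≤ 2≤x , x≤n

  cox-ascent : 1 ≤ n → ∀ {x} → x ≡ 1 ⊎ LowerBarred n π x → AscentStep x (cox n π x)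
  cox-ascent 1≤n {x} x-asc with cox n π x | cox-next-lower x-asc | ascending-bounds 1≤n x-asc
  ... | _ | within (here refl) x<1 _ | 1≤x , _ = contradiction x<1 (≤⇒≯ 1≤x)
  ... | y | within (there y∈) x<y between | 1≤x , _ =
    let ly@(_ , y≤n , _) = ∈-lowerList⁻ y∈ in
    x<y , inj₂ ly , λ x<z z<y →
      ∉lower⇒pp≡false (≤-<-trans 1≤x x<z) (<⇒≤ (<-≤-trans z<y y≤n)) λ z∈ →
        between (there z∈) x<z z<y
  ... | _ | beyond maximal | 1≤x , x≤n =
    s≤s x≤n , inj₁ refl , λ x<z z<1+n →
      ∉lower⇒pp≡false (≤-<-trans 1≤x x<z) (≤-pred z<1+n) λ z∈ → maximal (there z∈) x<z

  InZ-barred : ∀ {i j} → InZ n π i j → 2 ≤ j × j ≤ n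
  InZ-barred (inj₁ ((2≤j , j≤n , _) , _)) = 2≤j , j≤n
  InZ-barred (inj₂ ((2≤j , j≤n , _) , _)) = 2≤j , j≤n

  InZ-upper : ∀ {i j} → UpperBarred n π j → InZ n π i j → i ≤ (j ∸ 1) ⊓ (suc n ∸ j)
  InZ-upper _  (inj₁ (_ , _ , i≤m)) = i≤m
  InZ-upper uj (inj₂ (lj , _))      = contradiction uj (lower⇒¬upper lj)

  InZ-lower : ∀ {i j} → LowerBarred n π j → InZ n π i j → suc j ⊔ (n + 3 ∸ j) ≤ i
  InZ-lower lj (inj₁ (uj , _))      = contradiction uj (lower⇒¬upper lj)
  InZ-lower _  (inj₂ (_ , m≤i , _)) = m≤i

module Orbit (n : ℕ) (π : Permutation′ n) {u : ℕ} (ub : UpperBarred n π u) where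
  open Barred n π

  U L : ℕ → ℕ
  U = count≤ (not ∘ pp)
  L = count≤ pp

  data Phase (k x : ℕ) : Set where
    descending : UpperBarred n π x → x ≤ u → U x + k ≡ U u → Phase k x
    ascending  : x ≡ 1 ⊎ LowerBarred n π x → k ≡ L x + U u → Phase k x

  2≤u : 2 ≤ u
  2≤u = proj₁ ub

  u≤n : u ≤ n
  u≤n = proj₁ (proj₂ ub)

  u≡1+Lu+Uu : u ≡ suc (L u + U u)
  u≡1+Lu+Uu = count≤-partition pp (<⇒≤ 2≤u)

  descend : ∀ {k x y} → UpperBarred n π x → x ≤ u → U x + k ≡ U u → DescentStep x y →
            Phase (suc k) y
  descend {k} {x} {y} (2≤x , _ , pp≡false) x≤u Ux+k≡Uu (y<x , lands , skips) = phase lands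
    where
    Ux≡1+Uy : U x ≡ suc (U y)
    Ux≡1+Uy = count≤-next (not ∘ pp) 2≤x y<x (cong not pp≡false) λ y<z z<x →
      cong not (skips y<z z<x)
    Uy+1+k≡Uu : U y + suc k ≡ U u
    Uy+1+k≡Uu = trans (+-suc (U y) k) (trans (cong (_+ k) (sym Ux≡1+Uy)) Ux+k≡Uu)
    phase : y ≡ 1 ⊎ UpperBarred n π y → Phase (suc k) y
    phase (inj₁ refl) = ascending (inj₁ refl) Uy+1+k≡Uu
    phase (inj₂ uy)   = descending uy (≤-trans (<⇒≤ y<x) x≤u) Uy+1+k≡Uu

  ascend : ∀ {k x y} → x ≡ 1 ⊎ LowerBarred n π x → k ≡ L x + U u → suc k < u → AscentStep x y →
           Phase (suc k) y
  ascend {k} {x} {y} _ k≡Lx+Uu _ (x<y , inj₂ ly@(2≤y , _ , pp≡true) , skips) =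
    ascending (inj₂ ly) (trans (cong suc k≡Lx+Uu) (cong (_+ U u) (sym Ly≡1+Lx)))
    where
    Ly≡1+Lx : L y ≡ suc (L x)
    Ly≡1+Lx = count≤-next pp 2≤y x<y pp≡true skips
  ascend {k} {x} _ k≡Lx+Uu 1+k<u (_ , inj₁ refl , skips) = contradiction 1+k<u (≤⇒≯ u≤1+k)
    where
    Lu≤Lx : L u ≤ L x
    Lu≤Lx with ≤-total u x
    ... | inj₁ u≤x = count≤-mono pp u≤x
    ... | inj₂ x≤u =
      ≤-reflexive (count≤-gap pp x≤u λ x<z z≤u → skips x<z (s≤s (≤-trans z≤u u≤n)))
    u≤1+k : u ≤ suc k
    u≤1+k = begin
      u                  ≡⟨ u≡1+Lu+Uu ⟩
      suc (L u + U u)    ≤⟨ s≤s (+-monoˡ-≤ (U u) Lu≤Lx) ⟩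
      suc (L x + U u)    ≡⟨ cong suc k≡Lx+Uu ⟨
      suc k              ∎
      where open ≤-Reasoning

  orbit-phase : ∀ k → k < u → Phase k (coxPow n π k u)
  orbit-phase zero    _     = descending ub ≤-refl (+-identityʳ (U u))
  orbit-phase (suc k) 1+k<u with orbit-phase k (<⇒≤ 1+k<u)
  ... | descending ux x≤u Ux+k≡Uu = descend ux x≤u Ux+k≡Uu (cox-descent ux)
  ... | ascending x-asc k≡Lx+Uu  =
    ascend x-asc k≡Lx+Uu 1+k<u (cox-ascent (≤-trans (<⇒≤ 2≤u) u≤n) x-asc)

  ascending-<u : ∀ {k x} → LowerBarred n π x → k ≡ L x + U u → k < u → x < u
  ascending-<u {k} {x} lx@(2≤x , _ , pp≡true) k≡Lx+Uu k<u with <-cmp x u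
  ... | tri< x<u _ _ = x<u
  ... | tri≈ _ refl _ = contradiction ub (lower⇒¬upper lx)
  ... | tri> _ _ u<x = contradiction k<u (≤⇒≯ u≤k)
    where
    u≤k : u ≤ k
    u≤k = begin
      u                  ≡⟨ u≡1+Lu+Uu ⟩
      suc (L u) + U u    ≤⟨ +-monoˡ-≤ (U u) (count≤-strict pp 2≤x u<x pp≡true) ⟩
      L x + U u          ≡⟨ k≡Lx+Uu ⟨
      k                  ∎
      where open ≤-Reasoning

  ascending-≤k : ∀ {k x} → LowerBarred n π x → k ≡ L x + U u → k < u → x ≤ k
  ascending-≤k {k} {x} lx@(2≤x , _ , _) k≡Lx+Uu k<u = begin
    x                  ≡⟨ count≤-partition pp (<⇒≤ 2≤x) ⟩
    suc (L x + U x)    ≡⟨ +-suc (L x) (U x) ⟨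
    L x + suc (U x)    ≤⟨ +-monoʳ-≤ (L x) Ux<Uu ⟩
    L x + U u          ≡⟨ k≡Lx+Uu ⟨
    k                  ∎
    where
    open ≤-Reasoning
    Ux<Uu : U x < U u
    Ux<Uu = count≤-strict (not ∘ pp) 2≤u (ascending-<u lx k≡Lx+Uu k<u)
                          (cong not (proj₂ (proj₂ ub)))

  orbit-∉Z : ∀ {k} → k ≤ (u ∸ 1) ⊓ (suc n ∸ u) → ¬ InZ n π (n + 2 ∸ k) (coxPow n π k u)
  orbit-∉Z {k} k≤m = phase-∉Z (orbit-phase k k<u)
    where
    k<u : k < u
    k<u = m≤pred[n]⇒suc[m]≤n {{>-nonZero (<⇒≤ 2≤u)}} (≤-trans k≤m (m⊓n≤m _ _))
    k≤1+n-u : k ≤ suc n ∸ u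
    k≤1+n-u = ≤-trans k≤m (m⊓n≤n _ _)
    phase-∉Z : ∀ {x} → Phase k x → ¬ InZ n π (n + 2 ∸ k) x
    phase-∉Z {x} (descending ux x≤u _) inZ =
      <⇒≱ (k≤1+n∸u⇒u<n+2∸k (≤-trans u≤n (n≤1+n n)) k≤1+n-u)
          (≤-trans (InZ-upper ux inZ) (≤-trans (m⊓n≤m _ _) (≤-trans (m∸n≤m x 1) x≤u)))
    phase-∉Z (ascending (inj₁ refl) _) inZ = <-irrefl refl (proj₁ (InZ-barred inZ))
    phase-∉Z {x} (ascending (inj₂ lx) k≡Lx+Uu) inZ =
      <⇒≱ (<-≤-trans (x≤k⇒n+2∸k<n+3∸x x≤k k≤1+n) (m≤n⊔m (suc x) _)) (InZ-lower lx inZ)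
      where
      x≤k : x ≤ k
      x≤k = ascending-≤k lx k≡Lx+Uu k<u
      k≤1+n : k ≤ suc n
      k≤1+n = ≤-trans k≤1+n-u (m∸n≤m _ u)

open Barred using (InZ-barred; InZ-upper; InZ-lower)

proposition5p7 : (n : ℕ) (π : Permutation′ n) (i j : ℕ) →
    Recorded n π i j → ¬ InZ n π i j
proposition5p7 n π i j (lowerCol {d} ld _ i≤d-1) inZ =
  <⇒≱ (≤-trans (m≤m⊔n (suc d) (n + 3 ∸ d)) (InZ-lower n π ld inZ))
      (≤-trans i≤d-1 (m∸n≤m d 1))
proposition5p7 n π i j (lastCol _ _) inZ = 1+n≰n (proj₂ (InZ-barred n π inZ))
proposition5p7 n π i j (upperDiag ub _ k≤m) = Orbit.orbit-∉Z n π ub k≤m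
proposition5p7 n π i j (upperCol ub _ m<i _) inZ = <⇒≱ m<i (InZ-upper n π ub inZ)
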